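{- Let $v,d\ge0$, let $\varphi\in\mathbf{K}[v,d]$ and let $\omega$ be a prime orbit of $\mathbf{K}[v,d]$. If $[\varphi]$ contains some but not all minterms of $\omega$ (i.e. $\emptyset\ne[\varphi]\cap\omega\subsetneq\omega$), then there is a prime substitution $\varsigma\in\mathcal{S}_p(v,0)$ such that $[\varphi\wedge(\varphi\circ\varsigma)]\subsetneq[\varphi]$ (i.e. $[\varphi]\not\subseteq[\varphi\circ\varsigma]$).
   Context: Formulas are unimodal propositional formulas in variables $p_0,\dots,p_{v-1}$; $\mathbf{K}$ is the least normal modal logic. $\mathbf{K}[v,d]$ is the Lindenbaum–Tarski algebra of formulas in $p_0,\dots,p_{v-1}$ of modal degree $\le d$ modulo $\mathbf{K}$-equivalence; it is a finite Boolean algebra whose atoms (minterms) are: level 0: the $2^v$ conjunctions $\bigwedge_i\pm p_i$; level $d+1$: all $m\wedge\bigwedge_\mu\pm\Diamond\mu$ with $m$ a level-0 minterm and $\mu$ ranging over all level-$d$ minterms. Each $\varphi\in\mathbf{K}[v,d]$ is identified with its set $[\varphi]$ of minterms. A level-0 substitution is a tuple $(\sigma_0,\dots,\sigma_{v-1})$ of classical propositional formulas in $p_0,\dots,p_{v-1}$, acting by $\varphi\circ\sigma=\varphi(\sigma_0,\dots,\sigma_{v-1})$; with composition $(\sigma\sigma')_i=\sigma_i(\sigma'_0,\dots,\sigma'_{v-1})$ these form a monoid, whose group of invertible elements is $\mathcal{S}_p(v,0)$ (prime substitutions). Each prime substitution permutes the level-$d$ minterms via $\mu\mapsto\mu\circ\varsigma$,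 giving a group action of $\mathcal{S}_p(v,0)$ on the set of level-$d$ minterms; its orbits are called the prime orbits of $\mathbf{K}[v,d]$. -}

module Defs where

open import Data.Nat using (ℕ; zero; suc)
open import Data.Bool using (Bool; true; false; _∧_; _∨_)
open import Data.Bool.Properties using () renaming (_≟_ to _≟B_)
open import Data.Fin using (Fin)
open import Data.Vec using (Vec; []; _∷_; tabulate; lookup; fromList; toList; zipWith)
import Data.Vec.Properties as VecP
import Data.Product.Properties as ProdP
open import Data.List using (List; length; cartesianProduct; concatMap)
  renaming ([] to []ˡ; _∷_ to _∷ˡ_)
open import Data.Bool.ListAction using (or)
import Data.List as L
open import Data.Product using (Σ; _×_; _,_; ∃)
open import Relation.Binary.PropositionalEquality using (_≡_)
open import Relation.Binary.Definitions using (DecidableEquality)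
open import Relation.Nullary using (¬_)
open import Relation.Nullary.Decidable using (⌊_⌋)

-- A valuation / level-0 minterm ⋀ᵢ ±pᵢ is a vector of v booleans.
-- A classical propositional formula in p₀..p_{v-1}, up to classical
-- equivalence, is its truth function.

Val : ℕ → Set
Val v = Vec Bool v

Cl : ℕ → Set
Cl v = Val v → Bool

allVecs : (n : ℕ) → List (Vec Bool n)
allVecs zero    = [] ∷ˡ []ˡ
allVecs (suc n) = concatMap (λ xs → (true ∷ xs) ∷ˡ (false ∷ xs) ∷ˡ []ˡ) (allVecs n)

Subst : ℕ → Set
Subst v = Fin v → Cl v

applyS : {v : ℕ} → Subst v → Val v → Val v
applyS σ x = tabulate (λ i → σ i x)

_⊙_ : {v : ℕ} → Subst v → Subst v → Subst v
(σ ⊙ σ') i x = σ i (applyS σ' x)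

idS : {v : ℕ} → Subst v
idS i x = lookup x i

_≈S_ : {v : ℕ} → Subst v → Subst v → Set
σ ≈S σ' = ∀ i x → σ i x ≡ σ' i x

-- prime substitutions: invertible elements of the monoid,
-- packaged with a (two-sided) inverse
record Prime (v : ℕ) : Set where
  field
    sub   : Subst v
    inv   : Subst v
    invˡ  : (inv ⊙ sub) ≈S idS
    invʳ  : (sub ⊙ inv) ≈S idS
open Prime public

_⁻¹ : {v : ℕ} → Prime v → Prime v
ς ⁻¹ = record { sub = inv ς ; inv = sub ς ; invˡ = invʳ ς ; invʳ = invˡ ς }

-- Minterms of K[v,d], together with a fixed enumeration of them.
-- Level 0: a valuation m (the minterm ⋀ᵢ ±pᵢ).
-- Level d+1: a pair (m , s) standing for m ∧ ⋀_μ ±◇μ, where s is the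
-- characteristic vector (w.r.t. the enumeration `enum v d`) of the set of
-- level-d minterms μ occurring positively.

mutual
  Mt : ℕ → ℕ → Set
  Mt v zero    = Val v
  Mt v (suc d) = Val v × Vec Bool (length (enum v d))

  enum : (v d : ℕ) → List (Mt v d)
  enum v zero    = allVecs v
  enum v (suc d) = cartesianProduct (allVecs v) (allVecs (length (enum v d)))

decMt : (v d : ℕ) → DecidableEquality (Mt v d)
decMt v zero    = VecP.≡-dec _≟B_
decMt v (suc d) = ProdP.≡-dec (VecP.≡-dec _≟B_) (VecP.≡-dec _≟B_)

memb : (v d : ℕ) → Vec Bool (length (enum v d)) → Mt v d → Bool
memb v d s μ = or (toList (zipWith (λ ν b → ⌊ decMt v d ν μ ⌋ ∧ b) (fromList (enum v d)) s))

-- The action μ ↦ μ ∘ ς of a prime substitution on level-d minterms: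
--   level 0:   m ∘ ς is the unique valuation x with applyS (sub ς) x = m,
--              namely applyS (inv ς) m;
--   level d+1: (m ∧ ⋀_μ ±◇μ) ∘ ς = (m ∘ ς) ∧ ⋀_μ ±◇(μ ∘ ς), so ν occurs
--              positively iff ν ∘ ς⁻¹ occurs positively in the original.
act : {v : ℕ} → Prime v → (d : ℕ) → Mt v d → Mt v d
act ς zero    m       = applyS (inv ς) m
act {v} ς (suc d) (m , s) =
  applyS (inv ς) m ,
  tabulate (λ i → memb v d s (act (ς ⁻¹) d (L.lookup (enum v d) i)))

-- Elements of K[v,d], identified with their sets of level-d minterms.
KForm : ℕ → ℕ → Set
KForm v d = Mt v d → Bool

_∈F_ : {v d : ℕ} → Mt v d → KForm v d → Set
μ ∈F φ = φ μ ≡ true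

-- [φ ∘ ς] = { μ ∘ ς | μ ∈ [φ] }   (φ is the disjunction of its minterms)
_∈∘_ : {v d : ℕ} → Mt v d → KForm v d × Prime v → Set
_∈∘_ {v} {d} μ (φ , ς) = ∃ λ ν → ν ∈F φ × μ ≡ act ς d ν

InOrbit : {v d : ℕ} → Mt v d → Mt v d → Set
InOrbit {v} {d} μ₀ μ = ∃ λ (ς : Prime v) → μ ≡ act ς d μ₀

{-# OPTIONS --safe #-}
-- Prime substitutions act on level-d minterms by permutations: ς⁻¹ undoes ς,
-- so μ ↦ μ ∘ ς is injective. A proper, nonempty part of an orbit has a
-- boundary: an orbit element α ∈ [φ] that is the image α = β ∘ τ of an orbit
-- element β ∉ [φ] (one of α, β is the base point μ₀, according to whether
-- μ₀ ∈ [φ]). By injectivity β is the only preimage of α under τ, so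
-- α ∉ [φ ∘ τ], i.e. [φ] ⊈ [φ ∘ τ].
module Submission where

open import Defs
open import Data.Nat using (ℕ; zero; suc)
open import Data.Bool using (Bool; true; false; _∧_)
open import Data.Bool.Properties using (∨-identityʳ)
open import Data.Bool.ListAction using (or)
open import Data.Fin using (zero; suc)
open import Data.List using (List; []; _∷_; lookup; length)
open import Data.List.Membership.Propositional using (_∈_)
open import Data.List.Membership.Propositional.Properties
  using (∈-lookup; ∈-concatMap⁺; ∈-cartesianProduct⁺)
open import Data.List.Relation.Binary.Disjoint.Propositional using (Disjoint)
open import Data.List.Relation.Unary.All as All using (All; []; _∷_)
import Data.List.Relation.Unary.All.Properties as AllP
open import Data.List.Relation.Unary.AllPairs as AllPairs using ([]; _∷_)
import Data.List.Relation.Unary.AllPairs.Properties as AllPairsP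
open import Data.List.Relation.Unary.Any as Any using (here; there)
open import Data.List.Relation.Unary.Any.Properties using (lookup-index)
open import Data.List.Relation.Unary.Unique.Propositional using (Unique)
import Data.List.Relation.Unary.Unique.Propositional.Properties as UniqueP
open import Data.Product using (∃; _×_; _,_)
open import Data.Vec as Vec using (Vec; []; _∷_; tabulate)
import Data.Vec.Properties as VecP
open import Function using (_∘_)
open import Relation.Binary.Definitions using (DecidableEquality)
open import Relation.Binary.PropositionalEquality
  using (_≡_; _≢_; refl; sym; trans; cong; cong₂; module ≡-Reasoning)
open import Relation.Nullary using (¬_; yes; no; contradiction)
open import Relation.Nullary.Decidable using (⌊_⌋)

module Occurrence {A : Set} (_≟_ : DecidableEquality A) where

  -- `memb v d` of Defs is `occurs (enum v d)`.
  occurs : (E : List A) → Vec Bool (length E) → A → Bool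
  occurs E s μ = or (Vec.toList (Vec.zipWith (λ ν b → ⌊ ν ≟ μ ⌋ ∧ b) (Vec.fromList E) s))

  occurs-∉ : ∀ {x} E (s : Vec Bool (length E)) → All (x ≢_) E → occurs E s x ≡ false
  occurs-∉         []      []      []          = refl
  occurs-∉ {x} (y ∷ E) (b ∷ s) (x≢y ∷ x∉E) with y ≟ x
  ... | yes y≡x = contradiction (sym y≡x) x≢y
  ... | no  _   = occurs-∉ E s x∉E

  occurs-lookup : ∀ E (s : Vec Bool (length E)) i → Unique E →
                  occurs E s (lookup E i) ≡ Vec.lookup s i
  occurs-lookup (x ∷ E) (b ∷ s) zero (x∉E ∷ _) with x ≟ x
  ... | yes _   rewrite occurs-∉ E s x∉E = ∨-identityʳ b
  ... | no  x≢x = contradiction refl x≢x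
  occurs-lookup (x ∷ E) (b ∷ s) (suc i) (x∉E ∷ E!) with x ≟ lookup E i
  ... | yes x≡Eᵢ = contradiction x≡Eᵢ (All.lookup x∉E (∈-lookup i))
  ... | no  _    = occurs-lookup E s i E!

  occurs-tabulate : ∀ (f : A → Bool) E {x} → Unique E → x ∈ E →
                    occurs E (tabulate (f ∘ lookup E)) x ≡ f x
  occurs-tabulate f E E! x∈E = begin
    occurs E (tabulate (f ∘ lookup E)) _          ≡⟨ cong (occurs E _) x≡Eᵢ ⟩
    occurs E (tabulate (f ∘ lookup E)) (lookup E i) ≡⟨ occurs-lookup E _ i E! ⟩
    Vec.lookup (tabulate (f ∘ lookup E)) i         ≡⟨ VecP.lookup∘tabulate (f ∘ lookup E) i ⟩
    f (lookup E i)                                 ≡⟨ cong f (sym x≡Eᵢ) ⟩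
    f _                                            ∎
    where
    open ≡-Reasoning
    i = Any.index x∈E
    x≡Eᵢ = lookup-index x∈E

bothHeads : ∀ {n} → Vec Bool n → List (Vec Bool (suc n))
bothHeads xs = (true ∷ xs) ∷ (false ∷ xs) ∷ []

∈-allVecs : ∀ n (x : Vec Bool n) → x ∈ allVecs n
∈-allVecs zero    []       = here refl
∈-allVecs (suc n) (b ∷ xs) =
  ∈-concatMap⁺ bothHeads (Any.map (λ { refl → ∈-bothHeads b }) (∈-allVecs n xs))
  where
  ∈-bothHeads : ∀ b → (b ∷ xs) ∈ bothHeads xs
  ∈-bothHeads true  = here refl
  ∈-bothHeads false = there (here refl)

∈-bothHeads⇒tail : ∀ {n} {x : Vec Bool n} {w} → w ∈ bothHeads x → Vec.tail w ≡ x
∈-bothHeads⇒tail (here refl)         = refl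
∈-bothHeads⇒tail (there (here refl)) = refl

bothHeads-disjoint : ∀ {n} {x y : Vec Bool n} → x ≢ y → Disjoint (bothHeads x) (bothHeads y)
bothHeads-disjoint x≢y (w∈x , w∈y) = x≢y (trans (sym (∈-bothHeads⇒tail w∈x)) (∈-bothHeads⇒tail w∈y))

allVecs-unique : ∀ n → Unique (allVecs n)
allVecs-unique zero    = [] ∷ []
allVecs-unique (suc n) =
  UniqueP.concat⁺ (AllP.map⁺ (All.universal (λ _ → ((λ ()) ∷ []) ∷ [] ∷ []) (allVecs n)))
                  (AllPairsP.map⁺ (AllPairs.map bothHeads-disjoint (allVecs-unique n)))

∈-enum : ∀ v d (μ : Mt v d) → μ ∈ enum v d
∈-enum v zero    μ       = ∈-allVecs v μ
∈-enum v (suc d) (m , s) = ∈-cartesianProduct⁺ (∈-allVecs v m) (∈-allVecs _ s)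

enum-unique : ∀ v d → Unique (enum v d)
enum-unique v zero    = allVecs-unique v
enum-unique v (suc d) = UniqueP.cartesianProduct⁺ (allVecs-unique v) (allVecs-unique _)

applyS-inverse : ∀ {v} (ς : Prime v) (m : Val v) → applyS (sub ς) (applyS (inv ς) m) ≡ m
applyS-inverse ς m = trans (VecP.tabulate-cong (λ i → invʳ ς i m)) (VecP.tabulate∘lookup m)

act-inverse : ∀ {v} (ς : Prime v) d (μ : Mt v d) → act (ς ⁻¹) d (act ς d μ) ≡ μ
act-inverse ς zero    m       = applyS-inverse ς m
act-inverse {v} ς (suc d) (m , s) =
  cong₂ _,_ (applyS-inverse ς m) (trans (VecP.tabulate-cong diamond) (VecP.tabulate∘lookup s))
  where
  open Occurrence (decMt v d)
  open ≡-Reasoning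
  E = enum v d
  diamond : ∀ i → memb v d (tabulate (memb v d s ∘ act (ς ⁻¹) d ∘ lookup E)) (act ς d (lookup E i))
                  ≡ Vec.lookup s i
  diamond i = begin
    memb v d (tabulate (memb v d s ∘ act (ς ⁻¹) d ∘ lookup E)) (act ς d (lookup E i))
      ≡⟨ occurs-tabulate (memb v d s ∘ act (ς ⁻¹) d) E (enum-unique v d) (∈-enum v d _) ⟩
    memb v d s (act (ς ⁻¹) d (act ς d (lookup E i)))
      ≡⟨ cong (memb v d s) (act-inverse ς d (lookup E i)) ⟩
    memb v d s (lookup E i)
      ≡⟨ occurs-lookup E s i (enum-unique v d) ⟩
    Vec.lookup s i
      ∎

act-injective : ∀ {v} (ς : Prime v) d {μ ν : Mt v d} → act ς d μ ≡ act ς d ν → μ ≡ ν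
act-injective ς d {μ} {ν} eq = begin
  μ                              ≡⟨ sym (act-inverse ς d μ) ⟩
  act (ς ⁻¹) d (act ς d μ)        ≡⟨ cong (act (ς ⁻¹) d) eq ⟩
  act (ς ⁻¹) d (act ς d ν)        ≡⟨ act-inverse ς d ν ⟩
  ν                              ∎
  where open ≡-Reasoning

∉∘-image-of-∉ : ∀ {v d} (φ : KForm v d) (τ : Prime v) {α β : Mt v d} →
                φ β ≡ false → α ≡ act τ d β → ¬ α ∈∘ (φ , τ)
∉∘-image-of-∉ {d = d} φ τ β∉φ α≡βτ (ν , ν∈φ , α≡ντ) with act-injective τ d (trans (sym α≡ντ) α≡βτ)
... | refl = contradiction (trans (sym ν∈φ) β∉φ) λ ()

theorem5 : (v d : ℕ) (φ : KForm v d) (μ₀ : Mt v d) →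
    (∃ λ μ → InOrbit μ₀ μ × μ ∈F φ) →
    (∃ λ μ → InOrbit μ₀ μ × φ μ ≡ false) →
    ∃ λ (ς : Prime v) → ¬ (∀ μ → μ ∈F φ → μ ∈∘ (φ , ς))
theorem5 v d φ μ₀ (μ₁ , (ς₁ , μ₁≡μ₀ς₁) , μ₁∈φ) (μ₂ , (ς₂ , μ₂≡μ₀ς₂) , μ₂∉φ) with φ μ₀ in φμ₀
... | false = ς₁ , λ φ⊆φς₁ → ∉∘-image-of-∉ φ ς₁ φμ₀ μ₁≡μ₀ς₁ (φ⊆φς₁ μ₁ μ₁∈φ)
... | true  = ς₂ ⁻¹ , λ φ⊆φς₂⁻¹ → ∉∘-image-of-∉ φ (ς₂ ⁻¹) μ₂∉φ μ₀≡μ₂ς₂⁻¹ (φ⊆φς₂⁻¹ μ₀ φμ₀)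
  where
  μ₀≡μ₂ς₂⁻¹ : μ₀ ≡ act (ς₂ ⁻¹) d μ₂
  μ₀≡μ₂ς₂⁻¹ = trans (sym (act-inverse ς₂ d μ₀)) (cong (act (ς₂ ⁻¹) d) (sym μ₂≡μ₀ς₂))
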